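{- Suppose $F$ is an excellent filter on $\omega$. Then every ultrafilter $U$ on $\omega$ extending $F$ satisfies $\diamondsuit^-(U)$; in particular, every such $U$ is Tukey-top.
   Context: For a filter $F$ on $\omega$ and $\pi,f:\omega\to\omega$, $T\subseteq\mathcal{P}(\omega)$: $\diamondsuit^*(F,\pi,f,T)$ means there is $\langle\mathcal{A}_n\mid n<\omega\rangle$ with $\mathcal{A}_n\subseteq\mathcal{P}(f(n))$ (where $f(n)=\{0,\dots,f(n)-1\}$), $|\mathcal{A}_n|\le\pi(n)$, and $\{n\mid X\cap f(n)\in\mathcal{A}_n\}\in F$ for every $X\in T$; $\diamondsuit^-(F,\pi,f,T)$ is the same with "$\in F$" replaced by "meets every member of $F$". $F$ is excellent if there are $T\subseteq\mathcal{P}(\omega)$ with $|T|=\mathfrak{c}$ and $f,\pi:\omega\to\omega$ such that $\diamondsuit^*(F,\pi,f,T)$ holds and for every $g:\omega\to\omega$, $\{n\mid g(\pi(n))<f(n)\}\in F$. For an ultrafilter $U$, $\diamondsuit^-(U)$ means there are $\pi,f:\omega\to\omega$, $T\subseteq\mathcal{P}(\omega)$ with $|T|=\mathfrak{c}$, $\diamondsuit^-(U,\pi,f,T)$, and for every $h:\omega\to\omega$, $\{n\mid h(\pi(n))<f(n)\}\in U$. $U$ is Tukey-top if $W\le_T U$ for every ultrafilter $W$ on $\omega$, where for directed sets $D\le_T E$ iff there is a map $D\to E$ sending unbounded sets to unbounded sets, ultrafilters ordered by reverse inclusion. -}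

module Defs where

open import Level using (0ℓ)
open import Data.Nat using (ℕ; _<_)
open import Data.Bool using (Bool; true; false)
open import Data.Fin using (Fin; toℕ)
open import Data.Product using (Σ; ∃; _×_; _,_)
open import Data.Sum using (_⊎_)
open import Data.Empty using (⊥)
open import Relation.Nullary using (¬_)
open import Relation.Binary.PropositionalEquality using (_≡_)
open import Function.Bundles using (_⇔_)

-- Subsets of ω are (proof-relevant) predicates on ℕ.
PSet : Set₁
PSet = ℕ → Set

_⊆_ : PSet → PSet → Set
X ⊆ Y = ∀ n → X n → Y n

_≐_ : PSet → PSet → Set
X ≐ Y = ∀ n → X n ⇔ Y n

_∩_ : PSet → PSet → PSet
(X ∩ Y) n = X n × Y n

∅ : PSet
∅ n = ⊥

ω : PSet
ω n = Data.Unit.⊤ where import Data.Unit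

∁ : PSet → PSet
∁ X n = ¬ X n

Family : Set₁
Family = PSet → Set

record IsFilter (F : Family) : Set₁ where
  field
    full    : F ω
    proper  : ¬ F ∅
    upward  : ∀ X Y → X ⊆ Y → F X → F Y
    inter   : ∀ X Y → F X → F Y → F (X ∩ Y)

record IsUltrafilter (U : Family) : Set₁ where
  field
    filter : IsFilter U
    ultra  : ∀ X → U X ⊎ U (∁ X)

Meets : PSet → PSet → Set
Meets X Y = ∃ λ n → X n × Y n

-- |T| = 𝔠 : T ⊆ P(ω) contains an injective image of 2^ω
-- (|T| ≤ 𝔠 holds automatically since T ⊆ P(ω)).
HasSizeContinuum : Family → Set₁
HasSizeContinuum T =
  Σ ((ℕ → Bool) → PSet) λ e →
    (∀ b → T (e b)) × (∀ b c → e b ≐ e c → ∀ n → b n ≡ c n)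

-- A subset of f(n) = {0,…,m-1} is a characteristic function Fin m → Bool;
-- a family 𝒜 ⊆ P(m) with |𝒜| ≤ k is given by an enumeration Fin k → P(m).
SmallFam : ℕ → ℕ → Set
SmallFam k m = Fin k → Fin m → Bool

TraceIn : ∀ {k m} → PSet → SmallFam k m → Set
TraceIn {k} {m} X 𝒜 = ∃ λ (i : Fin k) → ∀ (j : Fin m) → (𝒜 i j ≡ true) ⇔ X (toℕ j)

DiamondStar : Family → (ℕ → ℕ) → (ℕ → ℕ) → Family → Set₁
DiamondStar F π f T =
  Σ ((n : ℕ) → SmallFam (π n) (f n)) λ 𝒜 →
    ∀ X → T X → F (λ n → TraceIn X (𝒜 n))

DiamondMinus : Family → (ℕ → ℕ) → (ℕ → ℕ) → Family → Set₁
DiamondMinus F π f T =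
  Σ ((n : ℕ) → SmallFam (π n) (f n)) λ 𝒜 →
    ∀ X → T X → ∀ Y → F Y → Meets (λ n → TraceIn X (𝒜 n)) Y

Excellent : Family → Set₁
Excellent F =
  Σ Family λ T → Σ (ℕ → ℕ) λ f → Σ (ℕ → ℕ) λ π →
    HasSizeContinuum T × DiamondStar F π f T ×
    (∀ (g : ℕ → ℕ) → F (λ n → g (π n) < f n))

DiamondMinusU : Family → Set₁
DiamondMinusU U =
  Σ (ℕ → ℕ) λ π → Σ (ℕ → ℕ) λ f → Σ Family λ T →
    HasSizeContinuum T × DiamondMinus U π f T ×
    (∀ (h : ℕ → ℕ) → U (λ n → h (π n) < f n))

-- Directed set (U, ⊇): 𝒳 is bounded if some B ∈ U satisfies B ⊆ A for all A ∈ 𝒳.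
Bounded : Family → Family → Set₁
Bounded U 𝒳 = Σ PSet λ B → U B × (∀ A → 𝒳 A → B ⊆ A)

Unbounded : Family → Family → Set₁
Unbounded U 𝒳 = ¬ Bounded U 𝒳

-- The same for an indexed family of sets (used for images {φ(A) | A ∈ 𝒳}).
UnboundedIdx : Family → {I : Set₁} → (I → PSet) → Set₁
UnboundedIdx U {I} x = ¬ (Σ PSet λ B → U B × (∀ i → B ⊆ x i))

_≤T_ : Family → Family → Set₁
W ≤T U =
  Σ ((A : PSet) → W A → PSet) λ φ →
    (∀ A (p : W A) → U (φ A p)) ×
    (∀ (𝒳 : Family) (sub : ∀ A → 𝒳 A → W A) →
       Unbounded W 𝒳 →
       UnboundedIdx U {Σ PSet 𝒳} (λ { (A , x) → φ A (sub A x) }))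

TukeyTop : Family → Set₁
TukeyTop U = ∀ (W : Family) → IsUltrafilter W → W ≤T U

-- Write Sᵦ = {n | e b ∩ f(n) ∈ 𝒜ₙ} for the 𝔠 many sets e b ∈ T. For an ultrafilter U ⊇ F,
-- ◇* transfers to ◇⁻(U), and conversely ◇⁻ makes every Sᵦ a member of U (its complement cannot
-- meet it). The Tukey map sends A to S_χ with χ the characteristic function of A. If B ∈ U lies below Sᵦ for infinitely many distinct
-- b, separate the first π(n)+1 of them below a bound g(π(n)); the growth condition yields n ∈ B
-- with g(π(n)) < f(n), so by pigeonhole two of them have the same trace on f(n), although they
-- differ below it. Hence only "finitely many" b lie above B, and the intersection of the
-- corresponding W-sets is a W-set bounding any family whose image B bounds.
module Submission where

open import Defs
open import Level using (0ℓ)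
open import Axiom.ExcludedMiddle using (ExcludedMiddle)
open import Axiom.DoubleNegationElimination using (em⇒dne)
open import Data.Bool using (Bool; T)
open import Data.Empty using (⊥-elim)
open import Data.Fin using (toℕ; fromℕ<)
open import Data.Fin.Properties using (pigeonhole; toℕ-fromℕ<; toℕ≤pred[n])
open import Data.List using (List; []; _∷_)
open import Data.List.Membership.Propositional using (_∈_)
open import Data.List.Relation.Unary.All as All using (All; []; _∷_)
open import Data.List.Relation.Unary.All.Properties using (¬Any⇒All¬)
open import Data.List.Relation.Unary.Any using (Any; here; there)
open import Data.Nat using (ℕ; zero; suc; _<_; _≤_; _⊔_; s≤s; _<?_)
open import Data.Nat.Properties
  using (m≤n⇒m<n∨m≡n; ≤-trans; <-trans; m≤m⊔n; m≤n⊔m; n<1+n)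
open import Data.Product using (Σ; ∃; _×_; _,_; proj₁; proj₂)
open import Data.Sum using (inj₁; inj₂)
open import Function.Bundles using (_⇔_; mk⇔; Equivalence)
open import Function.Properties.Equivalence using () renaming (sym to ⇔-sym; trans to ⇔-trans)
open import Relation.Nullary using (¬_; yes; no)
open import Relation.Nullary.Decidable using (isYes; toWitness; fromWitness)
open import Relation.Binary.PropositionalEquality using (_≡_; refl; _≗_; subst)

≐-sym : {X Y : PSet} → X ≐ Y → Y ≐ X
≐-sym X≐Y n = ⇔-sym (X≐Y n)

maxBelow : ℕ → (ℕ → ℕ) → ℕ
maxBelow zero    g = 0
maxBelow (suc m) g = g m ⊔ maxBelow m g

≤-maxBelow : ∀ m g {k} → k < m → g k ≤ maxBelow m g
≤-maxBelow (suc m) g (s≤s k≤m) with m≤n⇒m<n∨m≡n k≤m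
... | inj₁ k<m = ≤-trans (≤-maxBelow m g k<m) (m≤n⊔m (g m) (maxBelow m g))
... | inj₂ refl = m≤m⊔n (g m) (maxBelow m g)

pairBound : (ℕ → ℕ → ℕ) → ℕ → ℕ
pairBound d p = maxBelow (suc p) (λ i → maxBelow (suc p) (λ j → suc (d i j)))

<-pairBound : ∀ d p {i j} → i ≤ p → j ≤ p → d i j < pairBound d p
<-pairBound d p {i} i≤p j≤p =
  ≤-trans (≤-maxBelow (suc p) (λ j → suc (d i j)) (s≤s j≤p))
          (≤-maxBelow (suc p) (λ i → maxBelow (suc p) (λ j → suc (d i j))) (s≤s i≤p))

sameTrace⇒agree : ∀ {k m} (X Y : PSet) {𝒜 : SmallFam k m}
                  (tX : TraceIn X 𝒜) (tY : TraceIn Y 𝒜) → proj₁ tX ≡ proj₁ tY →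
                  ∀ {j} → j < m → X j ⇔ Y j
sameTrace⇒agree X Y (i , X∼i) (.i , Y∼i) refl j<m =
  subst (λ q → X q ⇔ Y q) (toℕ-fromℕ< j<m)
        (⇔-trans (⇔-sym (X∼i (fromℕ< j<m))) (Y∼i (fromℕ< j<m)))

DiamondStar-mono : ∀ {F U π f T} → (∀ X → F X → U X) → DiamondStar F π f T → DiamondStar U π f T
DiamondStar-mono F⊆U (𝒜 , guessed) = 𝒜 , λ X X∈T → F⊆U _ (guessed X X∈T)

diamondMinus⇒diamondStar : ∀ {U π f T} → IsUltrafilter U → DiamondMinus U π f T → DiamondStar U π f T
diamondMinus⇒diamondStar {U} {T = T} uU (𝒜 , meets) = 𝒜 , guessed
  where
  guessed : ∀ X → T X → U (λ n → TraceIn X (𝒜 n))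
  guessed X X∈T with IsUltrafilter.ultra uU (λ n → TraceIn X (𝒜 n))
  ... | inj₁ S∈U = S∈U
  ... | inj₂ ∁S∈U with meets X X∈T _ ∁S∈U
  ...   | _ , inS , notInS = ⊥-elim (notInS inS)

bset : (ℕ → Bool) → PSet
bset b n = T (b n)

≗⇒bset-≐ : ∀ {b c} → b ≗ c → bset b ≐ bset c
≗⇒bset-≐ {b} b≗c n = subst (λ x → bset b n ⇔ T x) (b≗c n) (mk⇔ (λ x → x) (λ x → x))

⋂[_∣_] : {I : Set} → (I → PSet) → (I → Set) → PSet
⋂[ G ∣ P ] k = ∀ i → P i → G i k

module Classical (em : ExcludedMiddle 0ℓ) where

  dne : ∀ {A : Set} → ¬ ¬ A → A
  dne = em⇒dne em

  χ : PSet → ℕ → Bool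
  χ A n = isYes (em {A n})

  bset-χ : ∀ A → bset (χ A) ≐ A
  bset-χ A n = mk⇔ (toWitness {a? = em}) (fromWitness {a? = em})

  filter-inhabited : ∀ {U} → IsFilter U → ∀ X → U X → ∃ X
  filter-inhabited fU X X∈U =
    dne λ empty → IsFilter.proper fU (IsFilter.upward fU X ∅ (λ n x → empty (n , x)) X∈U)

  diamondStar⇒diamondMinus : ∀ {U π f T} → IsFilter U → DiamondStar U π f T → DiamondMinus U π f T
  diamondStar⇒diamondMinus fU (𝒜 , guessed) =
    𝒜 , λ X X∈T Y Y∈U → filter-inhabited fU _ (IsFilter.inter fU _ _ (guessed X X∈T) Y∈U)

  differing-point : {Y Z : PSet} → ¬ (Y ≐ Z) → ∃ λ n → ¬ (Y n ⇔ Z n)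
  differing-point Y≠Z = dne λ none → Y≠Z λ n → dne λ differ → none (n , differ)

  separator : (X : ℕ → PSet) → (∀ i j → i < j → ¬ (X i ≐ X j)) →
              Σ (ℕ → ℕ → ℕ) λ d → ∀ i j → i < j → ¬ (X i (d i j) ⇔ X j (d i j))
  separator X distinct = (λ i j → proj₁ (sep i j)) , (λ i j → proj₂ (sep i j))
    where
    sep : ∀ i j → Σ ℕ λ n → i < j → ¬ (X i n ⇔ X j n)
    sep i j with i <? j
    ... | no i≮j = 0 , λ i<j → ⊥-elim (i≮j i<j)
    ... | yes i<j = let n , differ = differing-point (distinct i j i<j) in n , λ _ → differ

  module _ {U : Family} (fU : IsFilter U) {π f : ℕ → ℕ} (𝒜 : (n : ℕ) → SmallFam (π n) (f n))
           (growth : ∀ (g : ℕ → ℕ) → U (λ n → g (π n) < f n)) where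

    traced-not-separated : ∀ B → U B → (X : ℕ → PSet) →
      (∀ m → B ⊆ (λ n → TraceIn (X m) (𝒜 n))) →
      (d : ℕ → ℕ → ℕ) → ¬ (∀ i j → i < j → ¬ (X i (d i j) ⇔ X j (d i j)))
    traced-not-separated B B∈U X traced d separated
      with filter-inhabited fU _ (IsFilter.inter fU _ _ B∈U (growth (pairBound d)))
    ... | n , n∈B , bound<f
      with pigeonhole (n<1+n (π n)) (λ i → proj₁ (traced (toℕ i) n n∈B))
    ... | i , j , i<j , sameIndex =
      separated (toℕ i) (toℕ j) i<j
        (sameTrace⇒agree (X (toℕ i)) (X (toℕ j))
          (traced (toℕ i) n n∈B) (traced (toℕ j) n n∈B) sameIndex
          (<-trans (<-pairBound d (π n) (toℕ≤pred[n] i) (toℕ≤pred[n] j)) bound<f))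

    traced-not-distinct : ∀ B → U B → (X : ℕ → PSet) →
      (∀ m → B ⊆ (λ n → TraceIn (X m) (𝒜 n))) → ¬ (∀ i j → i < j → ¬ (X i ≐ X j))
    traced-not-distinct B B∈U X traced distinct =
      let d , separated = separator X distinct in traced-not-separated B B∈U X traced d separated

  module _ {W : Family} (fW : IsFilter W) {I : Set} (G : I → PSet) (P : I → Set)
           (P⇒∈W : ∀ i → P i → W (G i))
           (noDistinctSeq : ∀ (s : ℕ → I) → (∀ m → P (s m)) →
                            ¬ (∀ i j → i < j → ¬ (G (s i) ≐ G (s j)))) where

    ⋂ᴸ : List I → PSet
    ⋂ᴸ L k = All (λ i → G i k) L

    ⋂ᴸ-∈ : ∀ L → All P L → W (⋂ᴸ L)
    ⋂ᴸ-∈ []      []       = IsFilter.upward fW ω (⋂ᴸ []) (λ _ _ → []) (IsFilter.full fW)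
    ⋂ᴸ-∈ (i ∷ L) (p ∷ ps) =
      IsFilter.upward fW _ _ (λ _ (x , xs) → x ∷ xs) (IsFilter.inter fW _ _ (P⇒∈W i p) (⋂ᴸ-∈ L ps))

    ⋂ᴸ-covering-⊆ : ∀ L → (∀ i → P i → Any (λ c → G i ≐ G c) L) → ⋂ᴸ L ⊆ ⋂[ G ∣ P ]
    ⋂ᴸ-covering-⊆ L covering k inAll i p with All.lookupAny inAll (covering i p)
    ... | inG , G≐ = Equivalence.from (G≐ k) inG

    -- Were every P-member equal to one in a finite list L, ⋂[ G ∣ P ] would contain ⋂ᴸ L ∈ W.
    module Unbounded (⋂∉W : ¬ W ⋂[ G ∣ P ]) where

      fresh : ∀ L → All P L → Σ I λ i → P i × All (λ c → ¬ (G i ≐ G c)) L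
      fresh L ps with em {Σ I λ i → P i × ¬ Any (λ c → G i ≐ G c) L}
      ... | yes (i , p , new) = i , p , ¬Any⇒All¬ L new
      ... | no none = ⊥-elim (⋂∉W (IsFilter.upward fW _ _ (⋂ᴸ-covering-⊆ L covering) (⋂ᴸ-∈ L ps)))
        where
        covering : ∀ i → P i → Any (λ c → G i ≐ G c) L
        covering i p = dne λ new → none (i , p , new)

      mutual
        seq : ℕ → I
        seq m = proj₁ (fresh (prefix m) (prefix-P m))

        seq-P : ∀ m → P (seq m)
        seq-P m = proj₁ (proj₂ (fresh (prefix m) (prefix-P m)))

        prefix : ℕ → List I
        prefix zero    = []
        prefix (suc m) = seq m ∷ prefix m

        prefix-P : ∀ m → All P (prefix m)
        prefix-P zero    = []
        prefix-P (suc m) = seq-P m ∷ prefix-P m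

      seq-new : ∀ m → All (λ c → ¬ (G (seq m) ≐ G c)) (prefix m)
      seq-new m = proj₂ (proj₂ (fresh (prefix m) (prefix-P m)))

      ∈-prefix : ∀ {i m} → i < m → seq i ∈ prefix m
      ∈-prefix {i} {suc m} (s≤s i≤m) with m≤n⇒m<n∨m≡n i≤m
      ... | inj₁ i<m = there (∈-prefix i<m)
      ... | inj₂ refl = here refl

      seq-distinct : ∀ i j → i < j → ¬ (G (seq i) ≐ G (seq j))
      seq-distinct i j i<j Gi≐Gj = All.lookup (seq-new j) (∈-prefix i<j) (≐-sym Gi≐Gj)

    ⋂-∈ : W ⋂[ G ∣ P ]
    ⋂-∈ = dne λ ⋂∉W → let open Unbounded ⋂∉W in noDistinctSeq seq seq-P seq-distinct

  diamondStar⇒≤T : ∀ {U W T π f} → IsFilter U → IsFilter W → HasSizeContinuum T →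
    DiamondStar U π f T → (∀ (g : ℕ → ℕ) → U (λ n → g (π n) < f n)) → W ≤T U
  diamondStar⇒≤T {U} {W} fU fW (e , e∈T , e-inj) (𝒜 , guessed) growth =
    (λ A _ → S (χ A)) , (λ A _ → guessed (e (χ A)) (e∈T (χ A))) , preservesUnbounded
    where
    S : (ℕ → Bool) → PSet
    S b n = TraceIn (e b) (𝒜 n)

    preservesUnbounded : ∀ 𝒳 (𝒳⊆W : ∀ A → 𝒳 A → W A) → Unbounded W 𝒳 →
                         UnboundedIdx U {Σ PSet 𝒳} (λ { (A , _) → S (χ A) })
    preservesUnbounded 𝒳 𝒳⊆W unbounded (B , B∈U , B⊆S) =
      unbounded (⋂[ bset ∣ P ] , ⋂-∈ fW bset P (λ _ → proj₂) noDistinctSeq , ⋂⊆𝒳)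
      where
      P : (ℕ → Bool) → Set
      P b = B ⊆ S b × W (bset b)

      noDistinctSeq : ∀ s → (∀ m → P (s m)) → ¬ (∀ i j → i < j → ¬ (bset (s i) ≐ bset (s j)))
      noDistinctSeq s Ps distinct =
        traced-not-distinct fU 𝒜 growth B B∈U (λ m → e (s m)) (λ m → proj₁ (Ps m))
          λ i j i<j e≐ → distinct i j i<j (≗⇒bset-≐ (e-inj (s i) (s j) e≐))

      ⋂⊆𝒳 : ∀ A → 𝒳 A → ⋂[ bset ∣ P ] ⊆ A
      ⋂⊆𝒳 A A∈𝒳 k k∈⋂ = Equivalence.to (bset-χ A k) (k∈⋂ (χ A) (B⊆S (A , A∈𝒳) , χA∈W))
        where
        χA∈W : W (bset (χ A))
        χA∈W = IsFilter.upward fW A (bset (χ A)) (λ n → Equivalence.from (bset-χ A n)) (𝒳⊆W A A∈𝒳)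

  diamondMinusU⇒tukeyTop : ∀ {U} → IsUltrafilter U → DiamondMinusU U → TukeyTop U
  diamondMinusU⇒tukeyTop uU (π , f , T , |T|≡𝔠 , ◇⁻ , growth) W uW =
    diamondStar⇒≤T (IsUltrafilter.filter uU) (IsUltrafilter.filter uW) |T|≡𝔠
                   (diamondMinus⇒diamondStar uU ◇⁻) growth

mainTheorem12 : ExcludedMiddle 0ℓ →
    ∀ (F : Family) → IsFilter F → Excellent F →
    ∀ (U : Family) → IsUltrafilter U → (∀ X → F X → U X) →
    DiamondMinusU U × TukeyTop U
mainTheorem12 em F _ (T , f , π , |T|≡𝔠 , ◇* , growth) U uU F⊆U = ◇⁻U , diamondMinusU⇒tukeyTop uU ◇⁻U
  where
  open Classical em
  ◇⁻U : DiamondMinusU U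
  ◇⁻U = π , f , T , |T|≡𝔠 ,
        diamondStar⇒diamondMinus (IsUltrafilter.filter uU) (DiamondStar-mono F⊆U ◇*) ,
        λ h → F⊆U _ (growth h)
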